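{- Let $A,B,C\in\mathbb{Z}$ with $A\ge1$, $f(t)=A\binom{t}{4}+B\binom{t}{3}+C\binom{t}{2}+t$, $m\in\mathbb{Z}$, $s\ge17$ an integer, and $p\ge11$ a prime. Let $\mathcal{M}^*_m(p)$ be the number of $(n_1,\dots,n_s)\in\{1,\dots,p\}^s$ with $f(n_1)+\dots+f(n_s)\equiv m\pmod p$ such that $p\nmid f(n_1)$ and $p\nmid f'(n_1)$. Then $\mathcal{M}^*_m(p)\ge1$.
   Context: $f'$ is the derivative of the polynomial $f$; $f'(n)$ is a rational number whose denominator divides $12$, so for $p\ge11$ the condition $p\nmid f'(n)$ means $f'(n)\not\equiv0\pmod p$ in the $p$-adic sense (the numerator is not divisible by $p$). -}

module Defs where

open import Data.Nat as ℕ using (ℕ; zero; suc)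
open import Data.Nat.Combinatorics using (_C_)
open import Data.Fin using (Fin; zero; suc)
open import Data.Integer as ℤ using (ℤ; +_; _-_)
open import Data.Rational as ℚ using (ℚ; _/_)

f : ℤ → ℤ → ℤ → ℕ → ℤ
f A B c t = A ℤ.* (+ (t C 4)) ℤ.+ B ℤ.* (+ (t C 3)) ℤ.+ c ℤ.* (+ (t C 2)) ℤ.+ (+ t)

-- f'(t), the derivative of the polynomial f, as a rational number:
--   d/dt C(t,4) = (2t³ - 9t² + 11t - 3)/12
--   d/dt C(t,3) = (3t² - 6t + 2)/6
--   d/dt C(t,2) = (2t - 1)/2
--   d/dt t      = 1
f′ : ℤ → ℤ → ℤ → ℕ → ℚ
f′ A B c t =
  (A ℤ.* (+ 2 ℤ.* T ℤ.* T ℤ.* T - + 9 ℤ.* T ℤ.* T ℤ.+ + 11 ℤ.* T - + 3)) / 12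
  ℚ.+ (B ℤ.* (+ 3 ℤ.* T ℤ.* T - + 6 ℤ.* T ℤ.+ + 2)) / 6
  ℚ.+ (c ℤ.* (+ 2 ℤ.* T - + 1)) / 2
  ℚ.+ ℚ.1ℚ
  where T = + t

sumℤ : (s : ℕ) → (Fin s → ℤ) → ℤ
sumℤ zero    x = + 0
sumℤ (suc s) x = x zero ℤ.+ sumℤ s (λ i → x (suc i))

module Submission where

-- Since 24 (f(t) - y) is a quartic with a coefficient prime to p (as p ≥ 11), every
-- residue y is taken by f on {1, …, p} at most four times, so the set V of values of
-- f mod p has |V| ≥ p/4. By Cauchy–Davenport (proved by Dyson's e-transform), a sum of
-- k + 1 copies of V has at least min(p, (k + 1)|V| - k) residues, which is all of ℤ/p
-- once k ≥ 15. Choose n₁ outside the at most 4 + 3 roots of 24 f and 12 f′ mod p, and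
-- write m - f(n₁) as a sum of the remaining s - 1 ≥ 16 values.

open import Data.Nat using (ℕ; NonZero; _≤_)
open import Data.Nat.Primality using (Prime)
open import Data.Integer using (ℤ)

module Counting where

  open import Data.Bool using (Bool; true; false; _∧_; _∨_; not; T)
  open import Data.Unit using (tt)
  open import Data.Nat using (ℕ; zero; suc; _+_; _*_; _≤_; _<_; z≤n; s≤s; s≤s⁻¹; _≡ᵇ_)
  open import Data.Nat.Properties
  open import Algebra.Properties.CommutativeSemigroup +-commutativeSemigroup using (interchange; x∙yz≈y∙xz)
  open import Data.Product using (Σ; _×_; _,_)
  open import Data.Sum using (_⊎_; inj₁; inj₂)
  open import Data.Empty using (⊥-elim)
  open import Relation.Binary.PropositionalEquality

  true≢false : true ≢ false
  true≢false ()

  T⇒≡true : ∀ {b} → T b → b ≡ true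
  T⇒≡true {true} _ = refl

  ≡true⇒T : ∀ {b} → b ≡ true → T b
  ≡true⇒T refl = tt

  ∧≡true⇒ : ∀ {a b} → (a ∧ b) ≡ true → a ≡ true × b ≡ true
  ∧≡true⇒ {true} b≡true = refl , b≡true

  ∧-true : ∀ {a b} → a ≡ true → b ≡ true → (a ∧ b) ≡ true
  ∧-true refl refl = refl

  ∨≡true⇒ : ∀ {a b} → (a ∨ b) ≡ true → a ≡ true ⊎ b ≡ true
  ∨≡true⇒ {true}  _      = inj₁ refl
  ∨≡true⇒ {false} b≡true = inj₂ b≡true

  ∨-trueˡ : ∀ {a b} → a ≡ true → (a ∨ b) ≡ true
  ∨-trueˡ refl = refl

  ∨-trueʳ : ∀ {a b} → b ≡ true → (a ∨ b) ≡ true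
  ∨-trueʳ {true}  _      = refl
  ∨-trueʳ {false} b≡true = b≡true

  not≡true⇒ : ∀ {a} → not a ≡ true → a ≡ false
  not≡true⇒ {false} _ = refl

  not-false : ∀ {a} → a ≡ false → not a ≡ true
  not-false refl = refl

  indicator : Bool → ℕ
  indicator true  = 1
  indicator false = 0

  count : (ℕ → Bool) → ℕ → ℕ
  count P zero    = 0
  count P (suc n) = indicator (P n) + count P n

  private
    below-pred : ∀ {ℓ} {Q : ℕ → Set ℓ} {n} → (∀ x → x < suc n → Q x) → ∀ x → x < n → Q x
    below-pred h x x<n = h x (m≤n⇒m≤1+n x<n)

  count-cong : ∀ P Q n → (∀ x → x < n → P x ≡ Q x) → count P n ≡ count Q n
  count-cong P Q zero    h = refl
  count-cong P Q (suc n) h = cong₂ _+_ (cong indicator (h n ≤-refl)) (count-cong P Q n (below-pred h))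

  indicator-mono : ∀ a b → (a ≡ true → b ≡ true) → indicator a ≤ indicator b
  indicator-mono false b h = z≤n
  indicator-mono true  b h rewrite h refl = ≤-refl

  count-mono : ∀ P Q n → (∀ x → x < n → P x ≡ true → Q x ≡ true) → count P n ≤ count Q n
  count-mono P Q zero    h = z≤n
  count-mono P Q (suc n) h = +-mono-≤ (indicator-mono (P n) (Q n) (h n ≤-refl)) (count-mono P Q n (below-pred h))

  count-strict-mono : ∀ P Q n → (∀ x → x < n → P x ≡ true → Q x ≡ true) →
                      ∀ y → y < n → Q y ≡ true → P y ≡ false → count P n < count Q n
  count-strict-mono P Q (suc n) h y y<1+n qy py with m≤n⇒m<n∨m≡n (s≤s⁻¹ y<1+n)
  ... | inj₂ refl rewrite qy | py = s≤s (count-mono P Q n (below-pred h))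
  ... | inj₁ y<n  = +-mono-≤-< (indicator-mono (P n) (Q n) (h n ≤-refl))
                               (count-strict-mono P Q n (below-pred h) y y<n qy py)

  count-true : ∀ n → count (λ _ → true) n ≡ n
  count-true zero    = refl
  count-true (suc n) = cong suc (count-true n)

  count≤ : ∀ P n → count P n ≤ n
  count≤ P n = subst (count P n ≤_) (count-true n) (count-mono P (λ _ → true) n (λ _ _ _ → refl))

  count-false : ∀ P n → (∀ x → x < n → P x ≡ false) → count P n ≡ 0
  count-false P zero    h = refl
  count-false P (suc n) h rewrite h n ≤-refl = count-false P n (below-pred h)

  indicator-∨-∧ : ∀ a b → indicator (a ∨ b) + indicator (a ∧ b) ≡ indicator a + indicator b
  indicator-∨-∧ true  true  = refl
  indicator-∨-∧ true  false = refl
  indicator-∨-∧ false true  = refl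
  indicator-∨-∧ false false = refl

  count-∨+count-∧ : ∀ P Q n → count (λ x → P x ∨ Q x) n + count (λ x → P x ∧ Q x) n ≡ count P n + count Q n
  count-∨+count-∧ P Q zero    = refl
  count-∨+count-∧ P Q (suc n) = begin
    (indicator (P n ∨ Q n) + count P∨Q n) + (indicator (P n ∧ Q n) + count P∧Q n)
      ≡⟨ interchange (indicator (P n ∨ Q n)) (count P∨Q n) (indicator (P n ∧ Q n)) (count P∧Q n) ⟩
    (indicator (P n ∨ Q n) + indicator (P n ∧ Q n)) + (count P∨Q n + count P∧Q n)
      ≡⟨ cong₂ _+_ (indicator-∨-∧ (P n) (Q n)) (count-∨+count-∧ P Q n) ⟩
    (indicator (P n) + indicator (Q n)) + (count P n + count Q n)
      ≡⟨ interchange (indicator (P n)) (indicator (Q n)) (count P n) (count Q n) ⟩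
    (indicator (P n) + count P n) + (indicator (Q n) + count Q n) ∎
    where
    open ≡-Reasoning
    P∨Q = λ x → P x ∨ Q x
    P∧Q = λ x → P x ∧ Q x

  count-∨≤ : ∀ P Q n → count (λ x → P x ∨ Q x) n ≤ count P n + count Q n
  count-∨≤ P Q n = subst (count (λ x → P x ∨ Q x) n ≤_) (count-∨+count-∧ P Q n) (m≤m+n _ _)

  count-full : ∀ P n → n ≤ count P n → ∀ x → x < n → P x ≡ true
  count-full P (suc n) h x x<1+n with P n in eq
  ... | false = ⊥-elim (<⇒≱ (s≤s (count≤ P n)) h)
  ... | true with m≤n⇒m<n∨m≡n (s≤s⁻¹ x<1+n)
  ...   | inj₁ x<n  = count-full P n (s≤s⁻¹ h) x x<n
  ...   | inj₂ refl = eq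

  count-pos : ∀ P n x → x < n → P x ≡ true → 0 < count P n
  count-pos P (suc n) x x<1+n px with m≤n⇒m<n∨m≡n (s≤s⁻¹ x<1+n)
  ... | inj₂ refl rewrite px = s≤s z≤n
  ... | inj₁ x<n  = <-≤-trans (count-pos P n x x<n px) (m≤n+m (count P n) (indicator (P n)))

  search : ∀ (P : ℕ → Bool) n → Σ ℕ (λ x → x < n × P x ≡ true) ⊎ (∀ x → x < n → P x ≡ false)
  search P zero = inj₂ (λ _ ())
  search P (suc n) with P n in eq
  ... | true  = inj₁ (n , ≤-refl , eq)
  ... | false with search P n
  ...   | inj₁ (x , x<n , px) = inj₁ (x , m≤n⇒m≤1+n x<n , px)
  ...   | inj₂ none           = inj₂ extend
    where
    extend : ∀ x → x < suc n → P x ≡ false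
    extend x x<1+n with m≤n⇒m<n∨m≡n (s≤s⁻¹ x<1+n)
    ... | inj₁ x<n  = none x x<n
    ... | inj₂ refl = eq

  ≡ᵇ-true⇒≡ : ∀ {m n} → (m ≡ᵇ n) ≡ true → m ≡ n
  ≡ᵇ-true⇒≡ {m} {n} eq = ≡ᵇ⇒≡ m n (≡true⇒T eq)

  ≡ᵇ-refl : ∀ n → (n ≡ᵇ n) ≡ true
  ≡ᵇ-refl n = T⇒≡true (≡⇒≡ᵇ n n refl)

  ≢⇒≡ᵇ≡false : ∀ {m n} → m ≢ n → (m ≡ᵇ n) ≡ false
  ≢⇒≡ᵇ≡false {m} {n} m≢n with m ≡ᵇ n in eq
  ... | false = refl
  ... | true  = ⊥-elim (m≢n (≡ᵇ-true⇒≡ eq))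

  count-pos⇒witness : ∀ P n → 0 < count P n → Σ ℕ (λ x → x < n × P x ≡ true)
  count-pos⇒witness P n 0<count with search P n
  ... | inj₁ witness = witness
  ... | inj₂ none    = ⊥-elim (<-irrefl (sym (count-false P n none)) 0<count)

  count-singleton≤1 : ∀ r n → count (r ≡ᵇ_) n ≤ 1
  count-singleton≤1 r zero = z≤n
  count-singleton≤1 r (suc n) with r ≡ᵇ n in eq
  ... | false = count-singleton≤1 r n
  ... | true  = ≤-reflexive (cong suc (count-false _ n below))
    where
    below : ∀ x → x < n → (r ≡ᵇ x) ≡ false
    below x x<n = ≢⇒≡ᵇ≡false {r} {x} λ { refl → <-irrefl (≡ᵇ-true⇒≡ eq) x<n }

  count-singleton : ∀ r n → r < n → count (r ≡ᵇ_) n ≡ 1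
  count-singleton r n r<n = ≤-antisym (count-singleton≤1 r n) (count-pos (r ≡ᵇ_) n r r<n (≡ᵇ-refl r))

  anyBelow : (ℕ → Bool) → ℕ → Bool
  anyBelow P n with search P n
  ... | inj₁ _ = true
  ... | inj₂ _ = false

  anyBelow-sound : ∀ P n → anyBelow P n ≡ true → Σ ℕ (λ x → x < n × P x ≡ true)
  anyBelow-sound P n h with search P n
  ... | inj₁ witness = witness

  anyBelow-complete : ∀ P n x → x < n → P x ≡ true → anyBelow P n ≡ true
  anyBelow-complete P n x x<n px with search P n
  ... | inj₁ _    = refl
  ... | inj₂ none = ⊥-elim (true≢false (trans (sym px) (none x x<n)))

  count-+ : ∀ P a n → count P (a + n) ≡ count P a + count (λ i → P (a + i)) n
  count-+ P a zero    = trans (cong (count P) (+-identityʳ a)) (sym (+-identityʳ _))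
  count-+ P a (suc n) = begin
    count P (a + suc n)                                         ≡⟨ cong (count P) (+-suc a n) ⟩
    indicator (P (a + n)) + count P (a + n)                     ≡⟨ cong (indicator (P (a + n)) +_) (count-+ P a n) ⟩
    indicator (P (a + n)) + (count P a + count (λ i → P (a + i)) n) ≡⟨ x∙yz≈y∙xz (indicator (P (a + n))) (count P a) _ ⟩
    count P a + (indicator (P (a + n)) + count (λ i → P (a + i)) n) ∎
    where open ≡-Reasoning

  sumBelow : (ℕ → ℕ) → ℕ → ℕ
  sumBelow g zero    = 0
  sumBelow g (suc m) = g m + sumBelow g m

  sumBelow-mono : ∀ g h m → (∀ y → y < m → g y ≤ h y) → sumBelow g m ≤ sumBelow h m
  sumBelow-mono g h zero    le = z≤n
  sumBelow-mono g h (suc m) le = +-mono-≤ (le m ≤-refl) (sumBelow-mono g h m (below-pred le))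

  sumBelow-+ : ∀ g h m → sumBelow (λ y → g y + h y) m ≡ sumBelow g m + sumBelow h m
  sumBelow-+ g h zero    = refl
  sumBelow-+ g h (suc m) = trans (cong (g m + h m +_) (sumBelow-+ g h m))
                                 (interchange (g m) (h m) (sumBelow g m) (sumBelow h m))

  sumBelow-indicator : ∀ P m → sumBelow (λ y → indicator (P y)) m ≡ count P m
  sumBelow-indicator P zero    = refl
  sumBelow-indicator P (suc m) = cong (indicator (P m) +_) (sumBelow-indicator P m)

  sumBelow-*indicator : ∀ k P m → sumBelow (λ y → k * indicator (P y)) m ≡ k * count P m
  sumBelow-*indicator k P zero    = sym (*-zeroʳ k)
  sumBelow-*indicator k P (suc m) =
    trans (cong (k * indicator (P m) +_) (sumBelow-*indicator k P m)) (sym (*-distribˡ-+ k (indicator (P m)) (count P m)))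

  sumBelow-fibres : ∀ (g : ℕ → ℕ) m n → (∀ x → x < n → g x < m) → sumBelow (λ y → count (λ x → g x ≡ᵇ y) n) m ≡ n
  sumBelow-fibres g m zero    g<m = sumBelow-zero m
    where
    sumBelow-zero : ∀ m → sumBelow (λ _ → 0) m ≡ 0
    sumBelow-zero zero    = refl
    sumBelow-zero (suc m) = sumBelow-zero m
  sumBelow-fibres g m (suc n) g<m =
    trans (sumBelow-+ (λ y → indicator (g n ≡ᵇ y)) (λ y → count (λ x → g x ≡ᵇ y) n) m)
          (cong₂ _+_ (trans (sumBelow-indicator (g n ≡ᵇ_) m) (count-singleton (g n) m (g<m n ≤-refl))) (sumBelow-fibres g m n (below-pred g<m)))

  -- Double counting: the domain is the disjoint union of the fibres, each of size at most k.
  ≤-*-count-image : ∀ (g : ℕ → ℕ) (V : ℕ → Bool) m n k →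
                    (∀ x → x < n → g x < m) → (∀ x → x < n → V (g x) ≡ true) →
                    (∀ y → y < m → count (λ x → g x ≡ᵇ y) n ≤ k) → n ≤ k * count V m
  ≤-*-count-image g V m n k g<m g∈V fibre≤k = begin
    n                                                 ≡⟨ sumBelow-fibres g m n g<m ⟨
    sumBelow (λ y → count (λ x → g x ≡ᵇ y) n) m       ≤⟨ sumBelow-mono _ _ m fibre≤ ⟩
    sumBelow (λ y → k * indicator (V y)) m            ≡⟨ sumBelow-*indicator k V m ⟩
    k * count V m                                     ∎
    where
    open ≤-Reasoning
    fibre≤ : ∀ y → y < m → count (λ x → g x ≡ᵇ y) n ≤ k * indicator (V y)
    fibre≤ y y<m with V y in eq
    ... | true  = subst (count (λ x → g x ≡ᵇ y) n ≤_) (sym (*-identityʳ k)) (fibre≤k y y<m)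
    ... | false = ≤-reflexive (trans (count-false _ n outside) (sym (*-zeroʳ k)))
      where
      outside : ∀ x → x < n → (g x ≡ᵇ y) ≡ false
      outside x x<n = ≢⇒≡ᵇ≡false λ gx≡y → true≢false (trans (sym (g∈V x x<n)) (trans (cong V gx≡y) eq))

module Residues (p : ℕ) .{{_ : NonZero p}} where

  open import Data.Bool using (Bool; true; _∧_)
  open import Data.Nat using (zero; suc; z≤n; s≤s; _+_; _*_; _∸_; _≤_; _<_; _%_)
  open import Data.Nat.Properties
  open import Data.Nat.DivMod
  open import Data.Product using (Σ; _×_; _,_)
  open import Data.Empty using (⊥-elim)
  open import Relation.Binary.PropositionalEquality
  open Counting

  infix 4 _≈_
  _≈_ : ℕ → ℕ → Set
  x ≈ y = x % p ≡ y % p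

  ≈-+ : ∀ {a b c d} → a ≈ b → c ≈ d → a + c ≈ b + d
  ≈-+ {a} {b} {c} {d} a≈b c≈d =
    trans (%-distribˡ-+ a c p) (trans (cong₂ (λ u v → (u + v) % p) a≈b c≈d) (sym (%-distribˡ-+ b d p)))

  ≈-* : ∀ {a b c d} → a ≈ b → c ≈ d → a * c ≈ b * d
  ≈-* {a} {b} {c} {d} a≈b c≈d =
    trans (%-distribˡ-* a c p) (trans (cong₂ (λ u v → (u * v) % p) a≈b c≈d) (sym (%-distribˡ-* b d p)))

  %≈ : ∀ x → x % p ≈ x
  %≈ x = m%n%n≡m%n x p

  +*p≈ : ∀ x k → x + k * p ≈ x
  +*p≈ x k = [m+kn]%n≡m%n x k p

  +p≈ : ∀ x → x + p ≈ x
  +p≈ x = [m+n]%n≡m%n x p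

  ≈⇒≡ : ∀ {x y} → x < p → y < p → x ≈ y → x ≡ y
  ≈⇒≡ x<p y<p x≈y = trans (sym (m<n⇒m%n≡m x<p)) (trans x≈y (m<n⇒m%n≡m y<p))

  ≈-cancelʳ-+ : ∀ {a b} c → a + c ≈ b + c → a ≈ b
  ≈-cancelʳ-+ {a} {b} c h = begin
    a % p                       ≡⟨ +p≈ a ⟨
    (a + p) % p                 ≡⟨ cong (_% p) (complete a) ⟩
    (a + c′ + (p ∸ c′)) % p     ≡⟨ ≈-+ (≈-+ (refl {x = a % p}) (%≈ c)) refl ⟩
    (a + c + (p ∸ c′)) % p      ≡⟨ ≈-+ h refl ⟩
    (b + c + (p ∸ c′)) % p      ≡⟨ ≈-+ (≈-+ (refl {x = b % p}) (%≈ c)) refl ⟨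
    (b + c′ + (p ∸ c′)) % p     ≡⟨ cong (_% p) (complete b) ⟨
    (b + p) % p                 ≡⟨ +p≈ b ⟩
    b % p                       ∎
    where
    open ≡-Reasoning
    c′ = c % p
    complete : ∀ x → x + p ≡ x + c′ + (p ∸ c′)
    complete x = trans (cong (x +_) (sym (m+[n∸m]≡n (<⇒≤ (m%n<n c p))))) (sym (+-assoc x c′ (p ∸ c′)))

  infixl 6 _-ₚ_
  _-ₚ_ : ℕ → ℕ → ℕ
  z -ₚ y = (z + (p ∸ y)) % p

  -ₚ<p : ∀ z y → z -ₚ y < p
  -ₚ<p z y = m%n<n _ p

  -ₚ+ : ∀ z {y} → y ≤ p → z -ₚ y + y ≈ z
  -ₚ+ z {y} y≤p = begin
    (z -ₚ y + y) % p          ≡⟨ ≈-+ (%≈ (z + (p ∸ y))) (refl {x = y % p}) ⟩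
    (z + (p ∸ y) + y) % p     ≡⟨ cong (_% p) (trans (+-assoc z (p ∸ y) y) (cong (z +_) (m∸n+n≡m y≤p))) ⟩
    (z + p) % p               ≡⟨ +p≈ z ⟩
    z % p                     ∎
    where open ≡-Reasoning

  -ₚ-unique : ∀ {w z y} → y ≤ p → w < p → w + y ≈ z → w ≡ z -ₚ y
  -ₚ-unique {w} {z} {y} y≤p w<p h = ≈⇒≡ w<p (-ₚ<p z y) (≈-cancelʳ-+ y (trans h (sym (-ₚ+ z y≤p))))

  -ₚ-pos : ∀ {x y} → x < p → y < p → x ≢ y → 0 < y -ₚ x
  -ₚ-pos {x} {y} x<p y<p x≢y with y -ₚ x in eq
  ... | suc _ = s≤s z≤n
  ... | zero  = ⊥-elim (x≢y (≈⇒≡ x<p y<p (subst (λ w → w + x ≈ y) eq (-ₚ+ y (<⇒≤ x<p)))))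

  -ₚ-involutive : ∀ {x b} → b < p → x < p → x -ₚ (x -ₚ b) ≡ b
  -ₚ-involutive {x} {b} b<p x<p =
    sym (-ₚ-unique (<⇒≤ (-ₚ<p x b)) b<p (trans (cong (_% p) (+-comm b (x -ₚ b))) (-ₚ+ x (<⇒≤ b<p))))

  count-translate< : ∀ P e → e < p → count (λ x → P ((x + e) % p)) p ≡ count P p
  count-translate< P e e<p = begin
    count P′ p                                          ≡⟨ cong (count P′) (sym p-e+e) ⟩
    count P′ ((p ∸ e) + e)                              ≡⟨ count-+ P′ (p ∸ e) e ⟩
    count P′ (p ∸ e) + count (λ i → P′ (p ∸ e + i)) e  ≡⟨ cong₂ _+_ lower upper ⟩
    count (λ i → P (e + i)) (p ∸ e) + count P e         ≡⟨ +-comm _ (count P e) ⟩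
    count P e + count (λ i → P (e + i)) (p ∸ e)         ≡⟨ count-+ P e (p ∸ e) ⟨
    count P (e + (p ∸ e))                               ≡⟨ cong (count P) (m+[n∸m]≡n (<⇒≤ e<p)) ⟩
    count P p                                           ∎
    where
    open ≡-Reasoning
    P′ = λ x → P ((x + e) % p)
    p-e+e : (p ∸ e) + e ≡ p
    p-e+e = m∸n+n≡m (<⇒≤ e<p)
    lower : count P′ (p ∸ e) ≡ count (λ i → P (e + i)) (p ∸ e)
    lower = count-cong _ _ (p ∸ e) λ x x<p-e →
      cong P (trans (m<n⇒m%n≡m (subst (x + e <_) p-e+e (+-monoˡ-< e x<p-e))) (+-comm x e))
    wrap : ∀ i → (p ∸ e) + i + e ≡ i + p
    wrap i = trans (+-assoc (p ∸ e) i e) (trans (cong ((p ∸ e) +_) (+-comm i e))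
               (trans (sym (+-assoc (p ∸ e) e i)) (trans (cong (_+ i) p-e+e) (+-comm p i))))
    upper : count (λ i → P′ (p ∸ e + i)) e ≡ count P e
    upper = count-cong _ P e λ i i<e →
      cong P (trans (cong (_% p) (wrap i)) (trans (+p≈ i) (m<n⇒m%n≡m (<-trans i<e e<p))))

  count-translate : ∀ P e → count (λ x → P ((x + e) % p)) p ≡ count P p
  count-translate P e = trans (count-cong _ _ p (λ x _ → cong P (≈-+ (refl {x = x % p}) (sym (%≈ e)))))
                              (count-translate< P (e % p) (m%n<n e p))

  count-translate-ₚ : ∀ P e → count (λ x → P (x -ₚ e)) p ≡ count P p
  count-translate-ₚ P e = count-translate P (p ∸ e)

  infixl 6 _⊕_
  _⊕_ : (ℕ → Bool) → (ℕ → Bool) → ℕ → Bool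
  (S ⊕ T) z = anyBelow (λ y → S y ∧ T (z -ₚ y)) p

  ⊕-intro : ∀ S T z y → y < p → S y ≡ true → T (z -ₚ y) ≡ true → (S ⊕ T) z ≡ true
  ⊕-intro S T z y y<p sy ty = anyBelow-complete _ p y y<p (∧-true sy ty)

  ⊕-elim : ∀ S T z → (S ⊕ T) z ≡ true → Σ ℕ (λ y → y < p × S y ≡ true × T (z -ₚ y) ≡ true)
  ⊕-elim S T z h with anyBelow-sound _ p h
  ... | y , y<p , sy∧ty = y , y<p , ∧≡true⇒ sy∧ty

  count≤count-⊕ : ∀ A B b → b < p → B b ≡ true → count A p ≤ count (A ⊕ B) p
  count≤count-⊕ A B b b<p Bb = subst (_≤ count (A ⊕ B) p) (count-translate-ₚ A b)
    (count-mono _ _ p λ x x<p Ax-b → ⊕-intro A B x (x -ₚ b) (-ₚ<p x b) Ax-b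
      (subst (λ w → B w ≡ true) (sym (-ₚ-involutive b<p x<p)) Bb))

module IntegerResidues (p : ℕ) .{{_ : NonZero p}} where

  import Data.Nat as ℕ
  open import Data.Nat.Properties using (≤-total; m∸n+n≡m)
  open import Data.Nat.DivMod using (m≡m%n+[m/n]*n; m*n%n≡0)
  open import Data.Nat.Divisibility using (n∣m⇒m%n≡0)
  open import Data.Integer using (ℤ; +_; _+_; _-_; _*_; -_; _%ℕ_; _/ℕ_)
  open import Data.Integer.Properties using (pos-+; pos-*; [+m]-[+n]≡m⊖n; ⊖-≥)
  open import Data.Integer.DivMod using (a≡a%ℕn+[a/ℕn]*n; n%ℕd<d)
  open import Data.Integer.Divisibility.Signed using (_∣_; divides; ∣⇒∣ᵤ; ∣m⇒∣-m)
  open import Data.Integer.Tactic.RingSolver using (solve-∀)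
  open import Data.Sum using (inj₁; inj₂)
  open import Relation.Binary.PropositionalEquality
  open Residues p

  P : ℤ
  P = + p

  ≈⇒∣ : ∀ {a b} → a ≈ b → P ∣ (+ a - + b)
  ≈⇒∣ {a} {b} a≈b = divides (+ (a ℕ./ p) - + (b ℕ./ p)) (begin
    + a - + b                                                ≡⟨ cong₂ _-_ (split a) (split b) ⟩
    (+ (a ℕ.% p) + + (a ℕ./ p) * P) - (+ (b ℕ.% p) + + (b ℕ./ p) * P)
                                                             ≡⟨ cong (λ r → (+ (a ℕ.% p) + + (a ℕ./ p) * P) - (+ r + + (b ℕ./ p) * P)) (sym a≈b) ⟩
    (+ (a ℕ.% p) + + (a ℕ./ p) * P) - (+ (a ℕ.% p) + + (b ℕ./ p) * P)
                                                             ≡⟨ cancel (+ (a ℕ.% p)) (+ (a ℕ./ p)) (+ (b ℕ./ p)) P ⟩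
    (+ (a ℕ./ p) - + (b ℕ./ p)) * P                          ∎)
    where
    open ≡-Reasoning
    split : ∀ x → + x ≡ + (x ℕ.% p) + + (x ℕ./ p) * P
    split x = trans (cong +_ (m≡m%n+[m/n]*n x p)) (trans (pos-+ (x ℕ.% p) _) (cong (λ w → + (x ℕ.% p) + w) (pos-* (x ℕ./ p) p)))
    cancel : ∀ r x y P → (r + x * P) - (r + y * P) ≡ (x - y) * P
    cancel = solve-∀

  ∣⇒≈-≥ : ∀ {a b} → b ℕ.≤ a → P ∣ (+ a - + b) → a ≈ b
  ∣⇒≈-≥ {a} {b} b≤a P∣a-b = begin
    a ℕ.% p                    ≡⟨ cong (ℕ._% p) (m∸n+n≡m b≤a) ⟨
    (a ℕ.∸ b ℕ.+ b) ℕ.% p      ≡⟨ ≈-+ (trans (n∣m⇒m%n≡0 _ p p∣a∸b) (sym (m*n%n≡0 0 p))) (refl {x = b ℕ.% p}) ⟩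
    b ℕ.% p                    ∎
    where
    open ≡-Reasoning
    p∣a∸b = ∣⇒∣ᵤ (subst (P ∣_) (trans ([+m]-[+n]≡m⊖n a b) (⊖-≥ b≤a)) P∣a-b)

  ∣⇒≈ : ∀ {a b} → P ∣ (+ a - + b) → a ≈ b
  ∣⇒≈ {a} {b} P∣a-b with ≤-total b a
  ... | inj₁ b≤a = ∣⇒≈-≥ b≤a P∣a-b
  ... | inj₂ a≤b = sym (∣⇒≈-≥ a≤b (subst (P ∣_) (negate (+ a) (+ b)) (∣m⇒∣-m P∣a-b)))
    where
    negate : ∀ x y → - (x - y) ≡ y - x
    negate = solve-∀

  %ℕ<p : ∀ z → z %ℕ p ℕ.< p
  %ℕ<p z = n%ℕd<d z p

  ∣-%ℕ : ∀ z → P ∣ (z - + (z %ℕ p))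
  ∣-%ℕ z = divides (z /ℕ p) (trans (cong (_- + (z %ℕ p)) (a≡a%ℕn+[a/ℕn]*n z p)) (drop (+ (z %ℕ p)) (z /ℕ p) P))
    where
    drop : ∀ r q P → r + q * P - r ≡ q * P
    drop = solve-∀

module Polynomial where

  open import Data.Nat using (suc)
  open import Data.Integer using (ℤ; +_; _+_; _-_; _*_)
  open import Data.Integer.Divisibility.Signed using (_∣_; ∣m+n∣n⇒∣m; ∣n⇒∣m*n)
  open import Data.Integer.Tactic.RingSolver using (solve-∀)
  open import Data.List using (List; []; _∷_; length)
  open import Data.List.Relation.Unary.All using (All; []; _∷_)
  open import Relation.Binary.PropositionalEquality

  -- A polynomial is its list of coefficients, constant term first.
  eval : List ℤ → ℤ → ℤ
  eval []       x = + 0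
  eval (a ∷ as) x = a + x * eval as x

  -- Synthetic division by (x - r): the quotient, whose coefficients are the values at r
  -- of the successive tails.
  quot : List ℤ → ℤ → List ℤ
  quot []           r = []
  quot (a ∷ [])     r = []
  quot (a ∷ b ∷ bs) r = eval (b ∷ bs) r ∷ quot (b ∷ bs) r

  eval-quot : ∀ g x r → eval g x ≡ (x - r) * eval (quot g r) x + eval g r
  eval-quot [] x r = identity x r
    where
    identity : ∀ x r → + 0 ≡ (x - r) * + 0 + + 0
    identity = solve-∀
  eval-quot (a ∷ []) x r = identity a x r
    where
    identity : ∀ a x r → a + x * + 0 ≡ (x - r) * + 0 + (a + r * + 0)
    identity = solve-∀
  eval-quot (a ∷ b ∷ bs) x r = begin
    a + x * eval (b ∷ bs) x                               ≡⟨ cong (λ w → a + x * w) (eval-quot (b ∷ bs) x r) ⟩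
    a + x * ((x - r) * Q + E)                             ≡⟨ identity a x r Q E ⟩
    (x - r) * (E + x * Q) + (a + r * E)                   ∎
    where
    open ≡-Reasoning
    Q = eval (quot (b ∷ bs) r) x
    E = eval (b ∷ bs) r
    identity : ∀ a x r Q E → a + x * ((x - r) * Q + E) ≡ (x - r) * (E + x * Q) + (a + r * E)
    identity = solve-∀

  length-quot : ∀ a b bs r → length (quot (a ∷ b ∷ bs) r) ≡ length (b ∷ bs)
  length-quot a b []       r = refl
  length-quot a b (c ∷ cs) r = cong suc (length-quot b c cs r)

  All∣-quot⇒All∣ : ∀ {d} g r → d ∣ eval g r → All (d ∣_) (quot g r) → All (d ∣_) g
  All∣-quot⇒All∣ []           r _  _         = []
  All∣-quot⇒All∣ {d} (a ∷ []) r d∣a _         = subst (d ∣_) (identity a r) d∣a ∷ []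
    where
    identity : ∀ a r → a + r * + 0 ≡ a
    identity = solve-∀
  All∣-quot⇒All∣ (a ∷ b ∷ bs) r d∣g[r] (d∣E ∷ d∣Q) =
    ∣m+n∣n⇒∣m d∣g[r] (∣n⇒∣m*n r d∣E) ∷ All∣-quot⇒All∣ (b ∷ bs) r d∣E d∣Q

module RootBound (p : ℕ) (p-prime : Prime p) where

  open import Data.Bool using (Bool; true; _∨_)
  import Data.Nat as ℕ
  open import Data.Nat using (zero; suc; _≤_; _<_; _≡ᵇ_; z≤n; s≤s; NonZero)
  open import Data.Nat.Properties using (≤-trans; +-mono-≤; ≤-reflexive; module ≤-Reasoning)
  open import Data.Nat.Primality using (euclidsLemma; prime⇒nonZero)
  open import Data.Nat.Divisibility using () renaming (_∣_ to _ℕ∣_)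
  open import Data.Integer using (ℤ; +_; _+_; _-_; _*_; ∣_∣)
  open import Data.Integer.Properties using (abs-*)
  open import Data.Integer.Divisibility.Signed using (_∣_; _∣?_; ∣⇒∣ᵤ; ∣ᵤ⇒∣; ∣m+n∣n⇒∣m)
  open import Data.Integer.Tactic.RingSolver using (solve-∀)
  open import Data.List using (List; []; _∷_; length)
  open import Data.List.Relation.Unary.All using (All; []; _∷_)
  open import Data.Product using (_,_)
  open import Data.Sum using (_⊎_; inj₁; inj₂; map)
  open import Data.Empty using (⊥-elim)
  open import Relation.Nullary using (¬_)
  open import Relation.Nullary.Decidable using (isYes; toWitness; fromWitness)
  open import Relation.Binary.PropositionalEquality
  open Counting
  open Polynomial

  instance
    p-nonZero : NonZero p
    p-nonZero = prime⇒nonZero p-prime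

  open Residues p using (≈⇒≡)
  open IntegerResidues p public using (P)
  open IntegerResidues p using (∣⇒≈)

  euclid : ∀ a b → P ∣ a * b → (P ∣ a) ⊎ (P ∣ b)
  euclid a b P∣ab = map ∣ᵤ⇒∣ ∣ᵤ⇒∣ (euclidsLemma ∣ a ∣ ∣ b ∣ p-prime (subst (p ℕ∣_) (abs-* a b) (∣⇒∣ᵤ P∣ab)))

  -- x < p stands for the argument x + 1 ∈ {1, …, p}.
  root? : List ℤ → ℕ → Bool
  root? g x = isYes (P ∣? eval g (+ suc x))

  root?-sound : ∀ g x → root? g x ≡ true → P ∣ eval g (+ suc x)
  root?-sound g x g[x]≡0 = toWitness {a? = P ∣? eval g (+ suc x)} (≡true⇒T g[x]≡0)

  root?-complete : ∀ g x → P ∣ eval g (+ suc x) → root? g x ≡ true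
  root?-complete g x P∣g[x] = T⇒≡true (fromWitness {a? = P ∣? eval g (+ suc x)} P∣g[x])

  roots-of-factor : ∀ g r → r < p → root? g r ≡ true →
                    ∀ x → x < p → root? g x ≡ true → ((r ≡ᵇ x) ∨ root? (quot g (+ suc r)) x) ≡ true
  roots-of-factor g r r<p g[r]≡0 x x<p g[x]≡0
    with euclid (+ suc x - + suc r) (eval (quot g (+ suc r)) (+ suc x))
                (∣m+n∣n⇒∣m (subst (P ∣_) (eval-quot g (+ suc x) (+ suc r)) (root?-sound g x g[x]≡0)) (root?-sound g r g[r]≡0))
  ... | inj₁ P∣x-r = ∨-trueˡ (subst (λ w → (r ≡ᵇ w) ≡ true) (≈⇒≡ r<p x<p (sym (∣⇒≈ P∣x-r′))) (≡ᵇ-refl r))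
    where
    shift : ∀ x r → + suc x - + suc r ≡ + x - + r
    shift x r = cancel-suc (+ x) (+ r)
      where
      cancel-suc : ∀ x r → (+ 1 + x) - (+ 1 + r) ≡ x - r
      cancel-suc = solve-∀
    P∣x-r′ : P ∣ (+ x - + r)
    P∣x-r′ = subst (P ∣_) (shift x r) P∣x-r
  ... | inj₂ P∣q[x] = ∨-trueʳ (root?-complete (quot g (+ suc r)) x P∣q[x])

  count-root?≤ : ∀ n g → length g ≤ suc n → ¬ All (P ∣_) g → count (root? g) p ≤ n
  count-root?≤ n g len≤ g≢0 with search (root? g) p
  ... | inj₂ no-root = ≤-trans (≤-reflexive (count-false (root? g) p no-root)) z≤n
  ... | inj₁ (r , r<p , g[r]≡0) = bound n g len≤ g≢0 g[r]≡0
    where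
    bound : ∀ n g → length g ≤ suc n → ¬ All (P ∣_) g → root? g r ≡ true → count (root? g) p ≤ n
    bound n [] _ g≢0 _ = ⊥-elim (g≢0 [])
    bound n (a ∷ []) _ g≢0 g[r]≡0 = ⊥-elim (g≢0 (subst (P ∣_) (constant a (+ suc r)) (root?-sound (a ∷ []) r g[r]≡0) ∷ []))
      where
      constant : ∀ a x → a + x * + 0 ≡ a
      constant = solve-∀
    bound zero (a ∷ b ∷ bs) (s≤s ()) _ _
    bound (suc n) g@(a ∷ b ∷ bs) (s≤s len≤) g≢0 g[r]≡0 = begin
      count (root? g) p                                 ≤⟨ count-mono _ _ p (roots-of-factor g r r<p g[r]≡0) ⟩
      count (λ x → (r ≡ᵇ x) ∨ root? q x) p              ≤⟨ count-∨≤ (r ≡ᵇ_) (root? q) p ⟩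
      count (r ≡ᵇ_) p ℕ.+ count (root? q) p             ≤⟨ +-mono-≤ (count-singleton≤1 r p) (count-root?≤ n q len-q≤ q≢0) ⟩
      suc n                                             ∎
      where
      open ≤-Reasoning
      q = quot g (+ suc r)
      len-q≤ : length q ≤ suc n
      len-q≤ = subst (_≤ suc n) (sym (length-quot a b bs (+ suc r))) len≤
      q≢0 : ¬ All (P ∣_) q
      q≢0 q≡0 = g≢0 (All∣-quot⇒All∣ g (+ suc r) (root?-sound g r g[r]≡0) q≡0)

module CauchyDavenport (p : ℕ) (p-prime : Prime p) where

  open import Data.Bool using (Bool; true; false; _∧_; _∨_; not)
  open import Data.Bool.Properties using (∧-comm)
  open import Data.Nat using (zero; suc; pred; _+_; _*_; _∸_; _≤_; _<_; _%_; _≡ᵇ_; s≤s; s≤s⁻¹; NonZero; >-nonZero)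
  open import Data.Nat.Properties
  open import Data.Nat.DivMod using (m%n<n; m<n⇒m%n≡m)
  open import Data.Nat.Primality using (prime⇒nonZero)
  open import Data.Nat.Coprimality using (prime⇒coprime; coprime-Bézout)
  open import Data.Nat.GCD using (module Bézout)
  open import Data.Nat.Tactic.RingSolver using (solve-∀)
  open import Algebra.Properties.CommutativeSemigroup +-commutativeSemigroup using (x∙yz≈y∙xz; x∙yz≈x∙zy)
  open import Data.Product using (Σ; _,_; proj₁; proj₂)
  open import Data.Sum using (_⊎_; inj₁; inj₂)
  open import Data.Empty using (⊥-elim)
  open import Function using (_∘_)
  open import Relation.Binary.PropositionalEquality
  open Counting

  instance
    p-nonZero : NonZero p
    p-nonZero = prime⇒nonZero p-prime

  open Residues p

  inverse : ∀ d → 0 < d → d < p → Σ ℕ (λ u → u * d ≈ 1)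
  inverse d 0<d d<p with coprime-Bézout (prime⇒coprime p-prime {{>-nonZero 0<d}} d<p)
  ... | Bézout.-+ x y 1+xp≡yd = y , trans (cong (_% p) (sym 1+xp≡yd)) (+*p≈ 1 x)
  ... | Bézout.+- x y 1+yd≡xp = q * y , (begin
    (q * y * d) % p          ≡⟨ +p≈ (q * y * d) ⟨
    (q * y * d + p) % p      ≡⟨ cong (_% p) shift ⟩
    (1 + q * x * p) % p      ≡⟨ +*p≈ 1 (q * x) ⟩
    1 % p                    ∎)
    where
    open ≡-Reasoning
    q = pred p
    -- y is an inverse of -d, so (p - 1) * y is an inverse of d
    shift : q * y * d + p ≡ 1 + q * x * p
    shift = begin
      q * y * d + p           ≡⟨ cong (q * y * d +_) (sym (suc-pred p)) ⟩
      q * y * d + suc q       ≡⟨ expand q y d ⟩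
      1 + q * (1 + y * d)     ≡⟨ cong (λ w → 1 + q * w) 1+yd≡xp ⟩
      1 + q * (x * p)         ≡⟨ cong (1 +_) (sym (*-assoc q x p)) ⟩
      1 + q * x * p           ∎
      where
      expand : ∀ q y d → q * y * d + suc q ≡ 1 + q * (1 + y * d)
      expand = solve-∀

  ShiftClosed : (ℕ → Bool) → ℕ → Set
  ShiftClosed A d = ∀ x → x < p → A x ≡ true → A ((x + d) % p) ≡ true

  shift-closed-orbit : ∀ A d → ShiftClosed A d → ∀ a → A (a % p) ≡ true → ∀ k → A ((a + k * d) % p) ≡ true
  shift-closed-orbit A d closed a Aa zero    = subst (λ w → A (w % p) ≡ true) (sym (+-identityʳ a)) Aa
  shift-closed-orbit A d closed a Aa (suc k) =
    subst (λ w → A w ≡ true) step (closed _ (m%n<n _ p) (shift-closed-orbit A d closed a Aa k))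
    where
    step : ((a + k * d) % p + d) % p ≡ (a + suc k * d) % p
    step = trans (≈-+ (%≈ (a + k * d)) (refl {x = d % p}))
                 (cong (_% p) (trans (+-assoc a (k * d) d) (cong (a +_) (+-comm (k * d) d))))

  shift-closed⇒full : ∀ A d → 0 < d → d < p → ShiftClosed A d → 0 < count A p → ∀ z → z < p → A z ≡ true
  shift-closed⇒full A d 0<d d<p closed |A|>0 z z<p with count-pos⇒witness A p |A|>0
  ... | a , a<p , Aa =
    subst (λ w → A w ≡ true) (trans reach (m<n⇒m%n≡m z<p))
          (shift-closed-orbit A d closed a (subst (λ w → A w ≡ true) (sym (m<n⇒m%n≡m a<p)) Aa) (t * u))
    where
    u = proj₁ (inverse d 0<d d<p)
    t = z + (p ∸ a)
    reach : a + t * u * d ≈ z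
    reach = begin
      (a + t * u * d) % p      ≡⟨ cong (λ w → (a + w) % p) (*-assoc t u d) ⟩
      (a + t * (u * d)) % p    ≡⟨ ≈-+ (refl {x = a % p}) (≈-* (refl {x = t % p}) (proj₂ (inverse d 0<d d<p))) ⟩
      (a + t * 1) % p          ≡⟨ cong (λ w → (a + w) % p) (*-identityʳ t) ⟩
      (a + t) % p              ≡⟨ cong (_% p) (x∙yz≈y∙xz a z (p ∸ a)) ⟩
      (z + (a + (p ∸ a))) % p  ≡⟨ cong (λ w → (z + w) % p) (m+[n∸m]≡n (<⇒≤ a<p)) ⟩
      (z + p) % p              ≡⟨ +p≈ z ⟩
      z % p                    ∎
      where open ≡-Reasoning

  CauchyDavenportBound : (ℕ → Bool) → (ℕ → Bool) → Set
  CauchyDavenportBound A B = p ≤ count (A ⊕ B) p ⊎ count A p + count B p ≤ suc (count (A ⊕ B) p)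

  module DysonTransform (e : ℕ) (e<p : e < p) (A B : ℕ → Bool) where

    A′ B′ : ℕ → Bool
    A′ x = A x ∨ B (x -ₚ e)
    B′ x = B x ∧ A ((x + e) % p)

    count-A′+count-B′ : count A′ p + count B′ p ≡ count A p + count B p
    count-A′+count-B′ = begin
      count A′ p + count B′ p                            ≡⟨ cong (count A′ p +_) A∩[B+e]≅B′ ⟨
      count A′ p + count (λ x → A x ∧ B (x -ₚ e)) p      ≡⟨ count-∨+count-∧ A (λ x → B (x -ₚ e)) p ⟩
      count A p + count (λ x → B (x -ₚ e)) p             ≡⟨ cong (count A p +_) (count-translate-ₚ B e) ⟩
      count A p + count B p                              ∎
      where
      open ≡-Reasoning
      A∩[B+e]≅B′ : count (λ x → A x ∧ B (x -ₚ e)) p ≡ count B′ p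
      A∩[B+e]≅B′ = trans (count-cong _ (λ x → B′ (x -ₚ e)) p λ x x<p →
          trans (∧-comm (A x) (B (x -ₚ e)))
                (cong (λ w → B (x -ₚ e) ∧ A w) (sym (trans (-ₚ+ x (<⇒≤ e<p)) (m<n⇒m%n≡m x<p)))))
        (count-translate-ₚ B′ e)

    ⊕-A′-B′ : ∀ z → (A′ ⊕ B′) z ≡ true → (A ⊕ B) z ≡ true
    ⊕-A′-B′ z h with ⊕-elim A′ B′ z h
    ... | y , y<p , A′y , B′[z-y] with ∨≡true⇒ A′y | ∧≡true⇒ {B (z -ₚ y)} B′[z-y]
    ...   | inj₁ Ay      | B[z-y] , _     = ⊕-intro A B z y y<p Ay B[z-y]
    ...   | inj₂ B[y-e]  | _      , A[y′] = ⊕-intro A B z y′ (m%n<n _ p) A[y′] (subst (λ u → B u ≡ true) y-e≡z-y′ B[y-e])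
      where
      y′ = (z -ₚ y + e) % p
      y-e≡z-y′ : y -ₚ e ≡ z -ₚ y′
      y-e≡z-y′ = -ₚ-unique (<⇒≤ (m%n<n _ p)) (-ₚ<p y e) (begin
        (y -ₚ e + y′) % p            ≡⟨ ≈-+ (refl {x = (y -ₚ e) % p}) (%≈ (z -ₚ y + e)) ⟩
        (y -ₚ e + (z -ₚ y + e)) % p  ≡⟨ cong (_% p) (x∙yz≈x∙zy (y -ₚ e) (z -ₚ y) e) ⟩
        (y -ₚ e + (e + (z -ₚ y))) % p ≡⟨ cong (_% p) (sym (+-assoc (y -ₚ e) e (z -ₚ y))) ⟩
        (y -ₚ e + e + (z -ₚ y)) % p  ≡⟨ ≈-+ (-ₚ+ y (<⇒≤ e<p)) (refl {x = (z -ₚ y) % p}) ⟩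
        (y + (z -ₚ y)) % p           ≡⟨ cong (_% p) (+-comm y (z -ₚ y)) ⟩
        (z -ₚ y + y) % p             ≡⟨ -ₚ+ z (<⇒≤ y<p) ⟩
        z % p                        ∎)
        where open ≡-Reasoning

    bound-from-transform : CauchyDavenportBound A′ B′ → CauchyDavenportBound A B
    bound-from-transform (inj₁ full) = inj₁ (≤-trans full (count-mono _ _ p (λ z _ → ⊕-A′-B′ z)))
    bound-from-transform (inj₂ bound) = inj₂ (subst (_≤ suc (count (A ⊕ B) p)) count-A′+count-B′
      (≤-trans bound (s≤s (count-mono _ _ p (λ z _ → ⊕-A′-B′ z)))))

  bound-singleton : ∀ A B b → b < p → B b ≡ true → count B p ≤ 1 → CauchyDavenportBound A B
  bound-singleton A B b b<p Bb |B|≤1 =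
    inj₂ (subst (_≤ suc (count (A ⊕ B) p)) (+-comm (count B p) (count A p))
                (+-mono-≤ |B|≤1 (count≤count-⊕ A B b b<p Bb)))

  bound-periodic : ∀ A B d b → 0 < d → d < p → ShiftClosed A d → 0 < count A p →
                   b < p → B b ≡ true → CauchyDavenportBound A B
  bound-periodic A B d b 0<d d<p closed |A|>0 b<p Bb = inj₁ (begin
    p                    ≡⟨ count-true p ⟨
    count (λ _ → true) p ≤⟨ count-mono _ A p (λ z z<p _ → shift-closed⇒full A d 0<d d<p closed |A|>0 z z<p) ⟩
    count A p            ≤⟨ count≤count-⊕ A B b b<p Bb ⟩
    count (A ⊕ B) p      ∎)
    where open ≤-Reasoning

  -- Either A is invariant under the shift d = b₂ - b₁, or the Dyson transform at an
  -- a ∈ A with a + d ∉ A keeps b₁ and drops b₂ from B.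
  bound-two-points : ∀ n → (∀ A B → count B p ≤ n → 0 < count A p → 0 < count B p → CauchyDavenportBound A B) →
                     ∀ A B → count B p ≤ suc n → 0 < count A p →
                     ∀ b₁ b₂ → b₁ < p → b₂ < p → B b₁ ≡ true → B b₂ ≡ true → b₁ ≢ b₂ → CauchyDavenportBound A B
  bound-two-points n IH A B |B|≤1+n |A|>0 b₁ b₂ b₁<p b₂<p Bb₁ Bb₂ b₁≢b₂
    with search (λ x → A x ∧ not (A ((x + (b₂ -ₚ b₁)) % p))) p
  ... | inj₂ closed = bound-periodic A B d b₁ (-ₚ-pos b₁<p b₂<p b₁≢b₂) (-ₚ<p b₂ b₁) shift-closed |A|>0 b₁<p Bb₁
    where
    d = b₂ -ₚ b₁
    shift-closed : ShiftClosed A d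
    shift-closed x x<p Ax with A ((x + d) % p) in eq
    ... | true  = refl
    ... | false = ⊥-elim (true≢false (trans (sym (∧-true Ax (not-false eq))) (closed x x<p)))
  ... | inj₁ (a , a<p , Aa∧a+d∉A) = bound-from-transform (IH A′ B′ |B′|≤n |A′|>0 (count-pos B′ p b₁ b₁<p B′b₁))
    where
    d = b₂ -ₚ b₁
    e = a -ₚ b₁
    open DysonTransform e (-ₚ<p a b₁) A B
    b₁+e≈a : b₁ + e ≈ a
    b₁+e≈a = trans (cong (_% p) (+-comm b₁ e)) (-ₚ+ a (<⇒≤ b₁<p))
    B′b₁ : B′ b₁ ≡ true
    B′b₁ = ∧-true Bb₁ (subst (λ w → A w ≡ true) (sym (trans b₁+e≈a (m<n⇒m%n≡m a<p))) (proj₁ (∧≡true⇒ Aa∧a+d∉A)))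
    b₂+e≈a+d : b₂ + e ≈ a + d
    b₂+e≈a+d = begin
      (b₂ + e) % p          ≡⟨ ≈-+ (-ₚ+ b₂ (<⇒≤ b₁<p)) (refl {x = e % p}) ⟨
      (d + b₁ + e) % p      ≡⟨ cong (_% p) (+-assoc d b₁ e) ⟩
      (d + (b₁ + e)) % p    ≡⟨ ≈-+ (refl {x = d % p}) b₁+e≈a ⟩
      (d + a) % p           ≡⟨ cong (_% p) (+-comm d a) ⟩
      (a + d) % p           ∎
      where open ≡-Reasoning
    B′b₂ : B′ b₂ ≡ false
    B′b₂ rewrite Bb₂ = trans (cong A b₂+e≈a+d) (not≡true⇒ (proj₂ (∧≡true⇒ Aa∧a+d∉A)))
    |B′|≤n : count B′ p ≤ n
    |B′|≤n = s≤s⁻¹ (<-≤-trans (count-strict-mono B′ B p (λ _ _ → proj₁ ∘ ∧≡true⇒) b₂ b₂<p Bb₂ B′b₂) |B|≤1+n)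
    |A′|>0 : 0 < count A′ p
    |A′|>0 = <-≤-trans |A|>0 (count-mono A A′ p (λ _ _ → ∨-trueˡ))

  cauchy-davenport : ∀ A B → 0 < count A p → 0 < count B p → CauchyDavenportBound A B
  cauchy-davenport A B = bounded (count B p) A B ≤-refl
    where
    bounded : ∀ n A B → count B p ≤ n → 0 < count A p → 0 < count B p → CauchyDavenportBound A B
    bounded zero    A B |B|≤0   _     |B|>0 = ⊥-elim (<⇒≱ |B|>0 |B|≤0)
    bounded (suc n) A B |B|≤1+n |A|>0 |B|>0 with count-pos⇒witness B p |B|>0
    ... | b₁ , b₁<p , Bb₁ with search (λ x → B x ∧ not (b₁ ≡ᵇ x)) p
    ...   | inj₁ (b₂ , b₂<p , Bb₂∧b₂≢b₁) =
            bound-two-points n (bounded n) A B |B|≤1+n |A|>0 b₁ b₂ b₁<p b₂<p Bb₁ (proj₁ (∧≡true⇒ Bb₂∧b₂≢b₁))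
              λ { refl → true≢false (trans (sym (≡ᵇ-refl b₁)) (not≡true⇒ (proj₂ (∧≡true⇒ Bb₂∧b₂≢b₁)))) }
    ...   | inj₂ only-b₁ = bound-singleton A B b₁ b₁<p Bb₁
            (≤-trans (count-mono B (b₁ ≡ᵇ_) p is-b₁) (count-singleton≤1 b₁ p))
      where
      is-b₁ : ∀ x → x < p → B x ≡ true → (b₁ ≡ᵇ x) ≡ true
      is-b₁ x x<p Bx with b₁ ≡ᵇ x in eq
      ... | true  = refl
      ... | false = ⊥-elim (true≢false (trans (sym (∧-true Bx (not-false eq))) (only-b₁ x x<p)))

module Quartic where

  open import Defs
  open import Data.Nat using (ℕ; zero; suc)
  open import Data.Nat.Combinatorics using (_C_; nC1≡n; nCk+nC[k+1]≡[n+1]C[k+1])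
  open import Data.Integer using (ℤ; +_; _+_; _-_; _*_; -_)
  open import Data.Integer.Tactic.RingSolver using (solve-∀)
  open import Data.Rational as ℚ using (_/_; ↥_)
  open import Data.Rational.Properties using (↥-/; toℚᵘ-injective; toℚᵘ-fromℚᵘ; toℚᵘ-homo-+)
  open import Data.Integer.Divisibility.Signed using (_∣_; ∣m⇒∣m*n)
  open import Data.Rational.Unnormalised using (mkℚᵘ; *≡*)
  open import Data.Rational.Unnormalised.Properties using (≃-trans; ≃-sym; ≃-refl; +-cong)
  open import Data.List using (List; []; _∷_)
  open import Relation.Binary.PropositionalEquality
  open Polynomial

  open ≡-Reasoning

  pascal : ∀ n k → + (suc n C suc k) ≡ + (n C k) + + (n C suc k)
  pascal n k = sym (cong +_ (nCk+nC[k+1]≡[n+1]C[k+1] n k))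

  2*C[n,2] : ∀ n → + 2 * + (n C 2) ≡ + n * (+ n - + 1)
  2*C[n,2] zero    = refl
  2*C[n,2] (suc n) = begin
    + 2 * + (suc n C 2)                 ≡⟨ cong (+ 2 *_) (pascal n 1) ⟩
    + 2 * (+ (n C 1) + + (n C 2))       ≡⟨ cong (λ z → + 2 * (+ z + + (n C 2))) (nC1≡n n) ⟩
    + 2 * (+ n + + (n C 2))             ≡⟨ distrib (+ n) (+ (n C 2)) ⟩
    + 2 * + n + + 2 * + (n C 2)         ≡⟨ cong (λ w → + 2 * + n + w) (2*C[n,2] n) ⟩
    + 2 * + n + + n * (+ n - + 1)       ≡⟨ step (+ n) ⟩
    (+ 1 + + n) * ((+ 1 + + n) - + 1)   ∎
    where
    distrib : ∀ x y → + 2 * (x + y) ≡ + 2 * x + + 2 * y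
    distrib = solve-∀
    step : ∀ x → + 2 * x + x * (x - + 1) ≡ (+ 1 + x) * ((+ 1 + x) - + 1)
    step = solve-∀

  6*C[n,3] : ∀ n → + 6 * + (n C 3) ≡ + n * (+ n - + 1) * (+ n - + 2)
  6*C[n,3] zero    = refl
  6*C[n,3] (suc n) = begin
    + 6 * + (suc n C 3)                                          ≡⟨ cong (+ 6 *_) (pascal n 2) ⟩
    + 6 * (+ (n C 2) + + (n C 3))                                ≡⟨ distrib (+ (n C 2)) (+ (n C 3)) ⟩
    + 3 * (+ 2 * + (n C 2)) + + 6 * + (n C 3)                    ≡⟨ cong₂ (λ u v → + 3 * u + v) (2*C[n,2] n) (6*C[n,3] n) ⟩
    + 3 * (+ n * (+ n - + 1)) + + n * (+ n - + 1) * (+ n - + 2)  ≡⟨ step (+ n) ⟩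
    (+ 1 + + n) * ((+ 1 + + n) - + 1) * ((+ 1 + + n) - + 2)      ∎
    where
    distrib : ∀ x y → + 6 * (x + y) ≡ + 3 * (+ 2 * x) + + 6 * y
    distrib = solve-∀
    step : ∀ x → + 3 * (x * (x - + 1)) + x * (x - + 1) * (x - + 2) ≡ (+ 1 + x) * ((+ 1 + x) - + 1) * ((+ 1 + x) - + 2)
    step = solve-∀

  24*C[n,4] : ∀ n → + 24 * + (n C 4) ≡ + n * (+ n - + 1) * (+ n - + 2) * (+ n - + 3)
  24*C[n,4] zero    = refl
  24*C[n,4] (suc n) = begin
    + 24 * + (suc n C 4)                        ≡⟨ cong (+ 24 *_) (pascal n 3) ⟩
    + 24 * (+ (n C 3) + + (n C 4))              ≡⟨ distrib (+ (n C 3)) (+ (n C 4)) ⟩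
    + 4 * (+ 6 * + (n C 3)) + + 24 * + (n C 4)  ≡⟨ cong₂ (λ u v → + 4 * u + v) (6*C[n,3] n) (24*C[n,4] n) ⟩
    + 4 * (+ n * (+ n - + 1) * (+ n - + 2)) + + n * (+ n - + 1) * (+ n - + 2) * (+ n - + 3)
                                                ≡⟨ step (+ n) ⟩
    (+ 1 + + n) * ((+ 1 + + n) - + 1) * ((+ 1 + + n) - + 2) * ((+ 1 + + n) - + 3) ∎
    where
    distrib : ∀ x y → + 24 * (x + y) ≡ + 4 * (+ 6 * x) + + 24 * y
    distrib = solve-∀
    step : ∀ x → + 4 * (x * (x - + 1) * (x - + 2)) + x * (x - + 1) * (x - + 2) * (x - + 3)
               ≡ (+ 1 + x) * ((+ 1 + x) - + 1) * ((+ 1 + x) - + 2) * ((+ 1 + x) - + 3)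
    step = solve-∀

  poly-24[f-y] : ℤ → ℤ → ℤ → ℤ → List ℤ
  poly-24[f-y] A B c y =
    - (+ 24 * y) ∷ (+ 24 - + 6 * A + + 8 * B - + 12 * c) ∷ (+ 11 * A - + 12 * B + + 12 * c) ∷ (- (+ 6 * A) + + 4 * B) ∷ A ∷ []

  eval-poly-24[f-y] : ∀ A B c y n → eval (poly-24[f-y] A B c y) (+ n) ≡ + 24 * (f A B c n - y)
  eval-poly-24[f-y] A B c y n = begin
    eval (poly-24[f-y] A B c y) T
      ≡⟨ expand A B c y T ⟩
    A * (T * (T - + 1) * (T - + 2) * (T - + 3)) + + 4 * B * (T * (T - + 1) * (T - + 2)) + + 12 * c * (T * (T - + 1)) + + 24 * T - + 24 * y
      ≡⟨ cong₃ (λ u v w → A * u + + 4 * B * v + + 12 * c * w + + 24 * T - + 24 * y) (sym (24*C[n,4] n)) (sym (6*C[n,3] n)) (sym (2*C[n,2] n)) ⟩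
    A * (+ 24 * C4) + + 4 * B * (+ 6 * C3) + + 12 * c * (+ 2 * C2) + + 24 * T - + 24 * y
      ≡⟨ collect A B c y T C4 C3 C2 ⟩
    + 24 * (f A B c n - y) ∎
    where
    T  = + n
    C4 = + (n C 4)
    C3 = + (n C 3)
    C2 = + (n C 2)
    cong₃ : ∀ {a b c a′ b′ c′ : ℤ} (h : ℤ → ℤ → ℤ → ℤ) → a ≡ a′ → b ≡ b′ → c ≡ c′ → h a b c ≡ h a′ b′ c′
    cong₃ h refl refl refl = refl
    expand : ∀ A B c y T →
      - (+ 24 * y) + T * ((+ 24 - + 6 * A + + 8 * B - + 12 * c) + T * ((+ 11 * A - + 12 * B + + 12 * c) + T * ((- (+ 6 * A) + + 4 * B) + T * (A + T * + 0))))
      ≡ A * (T * (T - + 1) * (T - + 2) * (T - + 3)) + + 4 * B * (T * (T - + 1) * (T - + 2)) + + 12 * c * (T * (T - + 1)) + + 24 * T - + 24 * y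
    expand = solve-∀
    collect : ∀ A B c y T C4 C3 C2 →
      A * (+ 24 * C4) + + 4 * B * (+ 6 * C3) + + 12 * c * (+ 2 * C2) + + 24 * T - + 24 * y ≡ + 24 * (A * C4 + B * C3 + c * C2 + T - y)
    collect = solve-∀

  12f′ : ℤ → ℤ → ℤ → ℕ → ℤ
  12f′ A B c t = A * (+ 2 * T * T * T - + 9 * T * T + + 11 * T - + 3) + + 2 * (B * (+ 3 * T * T - + 6 * T + + 2))
                 + + 6 * (c * (+ 2 * T - + 1)) + + 12
    where T = + t

  f′≡12f′/12 : ∀ A B c t → f′ A B c t ≡ 12f′ A B c t / 12
  f′≡12f′/12 A B c t = common-denominator (A * (+ 2 * T * T * T - + 9 * T * T + + 11 * T - + 3)) (B * (+ 3 * T * T - + 6 * T + + 2)) (c * (+ 2 * T - + 1))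
    where
    T = + t
    -- mkℚᵘ n d denotes n / (d + 1)
    common-denominator : ∀ x y z → x / 12 ℚ.+ y / 6 ℚ.+ z / 2 ℚ.+ ℚ.1ℚ ≡ (x + + 2 * y + + 6 * z + + 12) / 12
    common-denominator x y z = toℚᵘ-injective (≃-trans
      (≃-trans (toℚᵘ-homo-+ (x / 12 ℚ.+ y / 6 ℚ.+ z / 2) ℚ.1ℚ)
        (+-cong (≃-trans (toℚᵘ-homo-+ (x / 12 ℚ.+ y / 6) (z / 2))
                  (+-cong (≃-trans (toℚᵘ-homo-+ (x / 12) (y / 6)) (+-cong (toℚᵘ-fromℚᵘ (mkℚᵘ x 11)) (toℚᵘ-fromℚᵘ (mkℚᵘ y 5))))
                          (toℚᵘ-fromℚᵘ (mkℚᵘ z 1))))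
                ≃-refl))
      (≃-trans (*≡* (cross-multiply x y z)) (≃-sym (toℚᵘ-fromℚᵘ (mkℚᵘ (x + + 2 * y + + 6 * z + + 12) 11)))))
      where
      cross-multiply : ∀ x y z → (((x * + 6 + y * + 12) * + 2 + z * + 72) * + 1 + + 1 * + 144) * + 12 ≡ (x + + 2 * y + + 6 * z + + 12) * + 144
      cross-multiply = solve-∀

  ∣↥f′⇒∣12f′ : ∀ {d} A B c t → d ∣ ↥ (f′ A B c t) → d ∣ 12f′ A B c t
  ∣↥f′⇒∣12f′ {d} A B c t d∣↥f′ = subst (d ∣_) (↥-/ (12f′ A B c t) 12)
    (∣m⇒∣m*n _ (subst (λ q → d ∣ ↥ q) (f′≡12f′/12 A B c t) d∣↥f′))

  poly-12f′ : ℤ → ℤ → ℤ → List ℤ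
  poly-12f′ A B c = (- (+ 3 * A) + + 4 * B - + 6 * c + + 12) ∷ (+ 11 * A - + 12 * B + + 12 * c) ∷ (- (+ 9 * A) + + 6 * B) ∷ (+ 2 * A) ∷ []

  eval-poly-12f′ : ∀ A B c t → eval (poly-12f′ A B c) (+ t) ≡ 12f′ A B c t
  eval-poly-12f′ A B c t = expand A B c (+ t)
    where
    expand : ∀ A B c T →
      (- (+ 3 * A) + + 4 * B - + 6 * c + + 12) + T * ((+ 11 * A - + 12 * B + + 12 * c) + T * ((- (+ 9 * A) + + 6 * B) + T * ((+ 2 * A) + T * + 0)))
      ≡ A * (+ 2 * T * T * T - + 9 * T * T + + 11 * T - + 3) + + 2 * (B * (+ 3 * T * T - + 6 * T + + 2)) + + 6 * (c * (+ 2 * T - + 1)) + + 12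
    expand = solve-∀

module Nonvanishing (p : ℕ) (p-prime : Prime p) (11≤p : 11 ≤ p) where

  open import Data.Nat as ℕ using (suc; _<_; _≤?_; s≤s)
  open import Data.Nat.Properties using (≤-trans; <⇒≱)
  open import Data.Nat.Divisibility using (∣⇒≤)
  open import Data.Integer using (+_; _+_; _-_; _*_; -_)
  open import Data.Integer.Divisibility.Signed using (_∣_; ∣⇒∣ᵤ; ∣m∣n⇒∣m+n; ∣m∣n⇒∣m-n; ∣n⇒∣m*n)
  open import Data.Integer.Tactic.RingSolver using (solve-∀)
  open import Data.List.Relation.Unary.All using (All; _∷_; [])
  open import Data.Sum using (inj₁; inj₂)
  open import Data.Empty using (⊥-elim)
  open import Relation.Nullary using (¬_)
  open import Relation.Nullary.Decidable using (True; toWitness)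
  open import Relation.Binary.PropositionalEquality
  open Quartic
  open RootBound p p-prime using (p-nonZero; P; euclid)

  ∤-small : ∀ k {1≤k : True (1 ≤? k)} {k≤10 : True (k ≤? 10)} → ¬ (P ∣ + k)
  ∤-small k@(suc _) {_} {k≤10} P∣k = <⇒≱ (≤-trans (s≤s (toWitness k≤10)) 11≤p) (∣⇒≤ (∣⇒∣ᵤ P∣k))

  cancel-small : ∀ k {x} {1≤k : True (1 ≤? k)} {k≤10 : True (k ≤? 10)} → P ∣ + k * x → P ∣ x
  cancel-small k {x} {1≤k} {k≤10} P∣kx with euclid (+ k) x P∣kx
  ... | inj₁ P∣k = ⊥-elim (∤-small k {1≤k} {k≤10} P∣k)
  ... | inj₂ P∣x = P∣x

  poly-24[f-y]≢0 : ∀ A B c y → ¬ All (P ∣_) (poly-24[f-y] A B c y)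
  poly-24[f-y]≢0 A B c y (_ ∷ P∣a₁ ∷ P∣a₂ ∷ P∣a₃ ∷ P∣A ∷ []) = ∤-small 8 (cancel-small 3 P∣24)
    where
    P∣B : P ∣ B
    P∣B = cancel-small 4 (subst (P ∣_) (identity A B) (∣m∣n⇒∣m+n P∣a₃ (∣n⇒∣m*n (+ 6) P∣A)))
      where
      identity : ∀ A B → (- (+ 6 * A) + + 4 * B) + + 6 * A ≡ + 4 * B
      identity = solve-∀
    P∣c : P ∣ c
    P∣c = cancel-small 3 (cancel-small 4 (subst (P ∣_) (identity A B c)
            (∣m∣n⇒∣m+n (∣m∣n⇒∣m-n P∣a₂ (∣n⇒∣m*n (+ 11) P∣A)) (∣n⇒∣m*n (+ 12) P∣B))))
      where
      identity : ∀ A B c → ((+ 11 * A - + 12 * B + + 12 * c) - + 11 * A) + + 12 * B ≡ + 4 * (+ 3 * c)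
      identity = solve-∀
    P∣24 : P ∣ + 3 * + 8
    P∣24 = subst (P ∣_) (identity A B c)
             (∣m∣n⇒∣m+n (∣m∣n⇒∣m-n (∣m∣n⇒∣m+n P∣a₁ (∣n⇒∣m*n (+ 6) P∣A)) (∣n⇒∣m*n (+ 8) P∣B)) (∣n⇒∣m*n (+ 12) P∣c))
      where
      identity : ∀ A B c → (((+ 24 - + 6 * A + + 8 * B - + 12 * c) + + 6 * A) - + 8 * B) + + 12 * c ≡ + 3 * + 8
      identity = solve-∀

  poly-12f′≢0 : ∀ A B c → ¬ All (P ∣_) (poly-12f′ A B c)
  poly-12f′≢0 A B c (P∣a₀ ∷ P∣a₁ ∷ P∣a₂ ∷ P∣2A ∷ []) = ∤-small 4 (cancel-small 3 P∣12)
    where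
    P∣A : P ∣ A
    P∣A = cancel-small 2 P∣2A
    P∣B : P ∣ B
    P∣B = cancel-small 6 (subst (P ∣_) (identity A B) (∣m∣n⇒∣m+n P∣a₂ (∣n⇒∣m*n (+ 9) P∣A)))
      where
      identity : ∀ A B → (- (+ 9 * A) + + 6 * B) + + 9 * A ≡ + 6 * B
      identity = solve-∀
    P∣c : P ∣ c
    P∣c = cancel-small 3 (cancel-small 4 (subst (P ∣_) (identity A B c)
            (∣m∣n⇒∣m+n (∣m∣n⇒∣m-n P∣a₁ (∣n⇒∣m*n (+ 11) P∣A)) (∣n⇒∣m*n (+ 12) P∣B))))
      where
      identity : ∀ A B c → ((+ 11 * A - + 12 * B + + 12 * c) - + 11 * A) + + 12 * B ≡ + 4 * (+ 3 * c)
      identity = solve-∀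
    P∣12 : P ∣ + 3 * + 4
    P∣12 = subst (P ∣_) (identity A B c)
             (∣m∣n⇒∣m+n (∣m∣n⇒∣m-n (∣m∣n⇒∣m+n P∣a₀ (∣n⇒∣m*n (+ 3) P∣A)) (∣n⇒∣m*n (+ 4) P∣B)) (∣n⇒∣m*n (+ 6) P∣c))
      where
      identity : ∀ A B c → (((- (+ 3 * A) + + 4 * B - + 6 * c + + 12) + + 3 * A) - + 4 * B) + + 6 * c ≡ + 3 * + 4
      identity = solve-∀

module ValueSums (p : ℕ) (p-prime : Prime p) (F : ℕ → ℤ) where

  open import Data.Bool using (Bool; true)
  open import Data.Nat as ℕ using (zero; suc; _≤_; _<_; _≡ᵇ_; s≤s⁻¹; >-nonZero⁻¹)
  open import Data.Nat.Properties
  open import Algebra.Properties.CommutativeSemigroup +-commutativeSemigroup using (x∙yz≈y∙xz)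
  open import Data.Integer using (+_; _+_; _-_; _%ℕ_)
  open import Data.Integer.Properties using (pos-+)
  open import Data.Integer.Divisibility.Signed using (_∣_; ∣m∣n⇒∣m+n)
  open import Data.Integer.Tactic.RingSolver using (solve-∀)
  open import Data.Fin using (Fin; zero; suc)
  open import Data.Product using (Σ; _×_; _,_)
  open import Data.Sum using (_⊎_; inj₁; inj₂)
  open import Relation.Binary.PropositionalEquality
  open import Defs using (sumℤ)
  open Counting
  open RootBound p p-prime using (p-nonZero; P)
  open Residues p
  open IntegerResidues p using (≈⇒∣; ∣-%ℕ; %ℕ<p)
  open CauchyDavenport p p-prime using (cauchy-davenport)

  value : ℕ → ℕ
  value x = F x %ℕ p

  Values : ℕ → Bool
  Values y = anyBelow (λ x → value x ≡ᵇ y) p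

  -- Sums k has k + 1 summands: the residues of F x₀ + ⋯ + F xₖ with all xᵢ < p.
  Sums : ℕ → ℕ → Bool
  Sums zero    = Values
  Sums (suc k) = Values ⊕ Sums k

  Representation : ℕ → ℕ → Set
  Representation k z = Σ (Fin (suc k) → ℕ) λ x → (∀ i → x i < p) × P ∣ (sumℤ (suc k) (λ i → F (x i)) - + z)

  Values-sound : ∀ y → Values y ≡ true → Σ ℕ λ x → x < p × P ∣ (F x - + y)
  Values-sound y Vy with anyBelow-sound _ p Vy
  ... | x , x<p , value≡y = x , x<p , subst (λ w → P ∣ (F x - + w)) (≡ᵇ-true⇒≡ value≡y) (∣-%ℕ (F x))

  Sums-sound : ∀ k z → Sums k z ≡ true → Representation k z
  Sums-sound zero z Vz with Values-sound z Vz
  ... | x , x<p , P∣Fx-z = (λ _ → x) , (λ _ → x<p) , subst (P ∣_) (identity (F x) (+ z)) P∣Fx-z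
    where
    identity : ∀ a z → a - z ≡ a + + 0 - z
    identity = solve-∀
  Sums-sound (suc k) z Sz with ⊕-elim Values (Sums k) z Sz
  ... | y , y<p , Vy , S[z-y] with Values-sound y Vy | Sums-sound k (z -ₚ y) S[z-y]
  ... | x₀ , x₀<p , P∣Fx₀-y | xs , xs<p , P∣S-[z-y] = x , x<p , P∣sum-z
    where
    x : Fin (suc (suc k)) → ℕ
    x zero    = x₀
    x (suc i) = xs i
    x<p : ∀ i → x i < p
    x<p zero    = x₀<p
    x<p (suc i) = xs<p i
    P∣y+[z-y]-z : P ∣ ((+ y + + (z -ₚ y)) - + z)
    P∣y+[z-y]-z = subst (λ w → P ∣ (w - + z)) (pos-+ y (z -ₚ y))
                        (≈⇒∣ (trans (cong (ℕ._% p) (+-comm y (z -ₚ y))) (-ₚ+ z (<⇒≤ y<p))))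
    P∣sum-z : P ∣ (F x₀ + sumℤ (suc k) (λ i → F (xs i)) - + z)
    P∣sum-z = subst (P ∣_) (regroup (F x₀) _ (+ y) (+ (z -ₚ y)) (+ z)) (∣m∣n⇒∣m+n (∣m∣n⇒∣m+n P∣Fx₀-y P∣S-[z-y]) P∣y+[z-y]-z)
      where
      regroup : ∀ a s y w z → (a - y) + (s - w) + ((y + w) - z) ≡ a + s - z
      regroup = solve-∀

  0<|Values| : 0 < count Values p
  0<|Values| = count-pos Values p (value 0) (%ℕ<p (F 0)) (anyBelow-complete _ p 0 (>-nonZero⁻¹ p) (≡ᵇ-refl (value 0)))

  |Values|≤|Sums| : ∀ k → count Values p ≤ count (Sums k) p
  |Values|≤|Sums| zero    = ≤-refl
  |Values|≤|Sums| (suc k) with count-pos⇒witness (Sums k) p (<-≤-trans 0<|Values| (|Values|≤|Sums| k))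
  ... | z , z<p , Sz = count≤count-⊕ Values (Sums k) z z<p Sz

  Sums-bound : ∀ k → p ≤ count (Sums k) p ⊎ suc k ℕ.* count Values p ≤ k ℕ.+ count (Sums k) p
  Sums-bound zero = inj₂ (≤-reflexive (+-identityʳ _))
  Sums-bound (suc k)
    with Sums-bound k | cauchy-davenport Values (Sums k) 0<|Values| (<-≤-trans 0<|Values| (|Values|≤|Sums| k))
  ... | _            | inj₁ full′ = inj₁ full′
  ... | inj₁ full    | inj₂ cd    = inj₁ (≤-trans full (s≤s⁻¹ (≤-trans (+-monoˡ-≤ S 0<|Values|) cd)))
    where S = count (Sums k) p
  ... | inj₂ growth  | inj₂ cd    = inj₂ (begin
    V ℕ.+ suc k ℕ.* V       ≤⟨ +-monoʳ-≤ V growth ⟩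
    V ℕ.+ (k ℕ.+ S)         ≡⟨ x∙yz≈y∙xz V k S ⟩
    k ℕ.+ (V ℕ.+ S)         ≤⟨ +-monoʳ-≤ k cd ⟩
    k ℕ.+ suc S′            ≡⟨ +-suc k S′ ⟩
    suc k ℕ.+ S′            ∎)
    where
    open ≤-Reasoning
    V = count Values p
    S = count (Sums k) p
    S′ = count (Sums (suc k)) p

  Sums-full : ∀ k → p ℕ.+ k ≤ suc k ℕ.* count Values p → ∀ z → z < p → Sums k z ≡ true
  Sums-full k large with Sums-bound k
  ... | inj₁ full   = count-full (Sums k) p full
  ... | inj₂ growth = count-full (Sums k) p (+-cancelˡ-≤ k p _ (subst (_≤ k ℕ.+ count (Sums k) p) (+-comm p k) (≤-trans large growth)))

module Construction where

  open import Defs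
  open import Data.Bool using (Bool; true; false; _∨_; not)
  open import Data.Bool.Properties using (not-involutive)
  open import Data.Nat as ℕ using (ℕ; zero; suc; _∸_; _≤_; _<_; _≡ᵇ_; s≤s; z≤n)
  open import Data.Nat.Properties using (≤-refl; ≤-trans; m≤m+n; +-mono-≤; +-monoʳ-≤; +-monoˡ-≤; *-monoʳ-≤; <⇒≱; m≤m*n; m+[n∸m]≡n; module ≤-Reasoning)
  open import Data.Nat.Tactic.RingSolver renaming (solve-∀ to solveℕ)
  open import Data.Nat.Primality using (Prime)
  open import Data.Fin using (Fin; zero; suc)
  open import Data.Integer using (ℤ; +_; _+_; _-_; _*_; _%ℕ_)
  open import Data.Integer.Properties using (+-identityʳ)
  open import Data.Integer.Divisibility.Signed using (_∣_; ∣n⇒∣m*n; ∣m∣n⇒∣m-n)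
  open import Data.Integer.Tactic.RingSolver using (solve-∀)
  open import Data.Product using (Σ; _×_; _,_; proj₁; proj₂)
  open import Data.Sum using (inj₁; inj₂)
  open import Data.Empty using (⊥-elim)
  open import Relation.Nullary using (¬_)
  open import Relation.Binary.PropositionalEquality
  open Counting
  open Polynomial using (eval)
  open Quartic

  p+k≤[1+k]*v : ∀ {p v} k → 5 ≤ p → 0 < v → p ≤ 4 ℕ.* v → 15 ≤ k → p ℕ.+ k ≤ suc k ℕ.* v
  p+k≤[1+k]*v {p} {v@(suc _)} k 5≤p _ p≤4v 15≤k = subst (λ k → p ℕ.+ k ≤ suc k ℕ.* v) (m+[n∸m]≡n 15≤k) (begin
    p ℕ.+ (15 ℕ.+ j)            ≤⟨ +-monoʳ-≤ p (+-monoˡ-≤ j (*-monoʳ-≤ 3 5≤p)) ⟩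
    p ℕ.+ (3 ℕ.* p ℕ.+ j)       ≡⟨ regroup p j ⟩
    4 ℕ.* p ℕ.+ j               ≤⟨ +-mono-≤ (*-monoʳ-≤ 4 p≤4v) (m≤m*n j v) ⟩
    4 ℕ.* (4 ℕ.* v) ℕ.+ j ℕ.* v ≡⟨ collect v j ⟩
    (16 ℕ.+ j) ℕ.* v            ∎)
    where
    open ≤-Reasoning
    j = k ∸ 15
    regroup : ∀ p j → p ℕ.+ (3 ℕ.* p ℕ.+ j) ≡ 4 ℕ.* p ℕ.+ j
    regroup = solveℕ
    collect : ∀ v j → 4 ℕ.* (4 ℕ.* v) ℕ.+ j ℕ.* v ≡ (16 ℕ.+ j) ℕ.* v
    collect = solveℕ

  module _ (A B c : ℤ) (p : ℕ) (p-prime : Prime p) (11≤p : 11 ≤ p) where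

    open RootBound p p-prime
    open IntegerResidues p using (∣-%ℕ; %ℕ<p)
    open Nonvanishing p p-prime 11≤p

    F : ℕ → ℤ
    F x = f A B c (suc x)

    open ValueSums p p-prime F

    root-of-24[f-y] : ∀ y x → P ∣ (F x - y) → root? (poly-24[f-y] A B c y) x ≡ true
    root-of-24[f-y] y x P∣Fx-y = root?-complete (poly-24[f-y] A B c y) x (subst (P ∣_) (sym (eval-poly-24[f-y] A B c y (suc x))) (∣n⇒∣m*n (+ 24) P∣Fx-y))

    fibre≤4 : ∀ y → y < p → count (λ x → value x ≡ᵇ y) p ≤ 4
    fibre≤4 y _ = ≤-trans (count-mono _ _ p on-root) (count-root?≤ 4 (poly-24[f-y] A B c (+ y)) ≤-refl (poly-24[f-y]≢0 A B c (+ y)))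
      where
      on-root : ∀ x → x < p → (value x ≡ᵇ y) ≡ true → root? (poly-24[f-y] A B c (+ y)) x ≡ true
      on-root x _ value≡y = root-of-24[f-y] (+ y) x (subst (λ w → P ∣ (F x - + w)) (≡ᵇ-true⇒≡ value≡y) (∣-%ℕ (F x)))

    p≤4*|Values| : p ≤ 4 ℕ.* count Values p
    p≤4*|Values| = ≤-*-count-image value Values p p 4 (λ x _ → %ℕ<p (F x))
                     (λ x x<p → anyBelow-complete _ p x x<p (≡ᵇ-refl (value x))) fibre≤4

    Bad : ℕ → Bool
    Bad x = root? (poly-24[f-y] A B c (+ 0)) x ∨ root? (poly-12f′ A B c) x

    |Bad|≤7 : count Bad p ≤ 7
    |Bad|≤7 = ≤-trans (count-∨≤ _ _ p)
                (+-mono-≤ (count-root?≤ 4 _ ≤-refl (poly-24[f-y]≢0 A B c (+ 0))) (count-root?≤ 3 _ ≤-refl (poly-12f′≢0 A B c)))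

    good-point : Σ ℕ λ x → x < p × ¬ (P ∣ F x) × ¬ (P ∣ 12f′ A B c (suc x))
    good-point with search (λ x → not (Bad x)) p
    ... | inj₂ all-bad = ⊥-elim (<⇒≱ (≤-trans (s≤s |Bad|≤7) (≤-trans (m≤m+n 8 3) 11≤p)) p≤|Bad|)
      where
      p≤|Bad| : p ≤ count Bad p
      p≤|Bad| = subst (_≤ count Bad p) (count-true p) (count-mono _ Bad p λ x x<p _ →
                  trans (sym (not-involutive (Bad x))) (cong not (all-bad x x<p)))
    ... | inj₁ (x , x<p , good) = x , x<p , F≢0 , f′≢0
      where
      good′ : Bad x ≡ false
      good′ = not≡true⇒ good
      F≢0 : ¬ (P ∣ F x)
      F≢0 P∣Fx = true≢false (trans (sym (∨-trueˡ (root-of-24[f-y] (+ 0) x (subst (P ∣_) (sym (+-identityʳ (F x))) P∣Fx)))) good′)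
      f′≢0 : ¬ (P ∣ 12f′ A B c (suc x))
      f′≢0 P∣f′ = true≢false (trans (sym (∨-trueʳ {root? (poly-24[f-y] A B c (+ 0)) x}
                    (root?-complete (poly-12f′ A B c) x (subst (P ∣_) (sym (eval-poly-12f′ A B c (suc x))) P∣f′)))) good′)

    witness : ∀ m k → 15 ≤ k → Σ (Fin (suc (suc k)) → ℕ) λ n →
                (∀ i → 1 ≤ n i × n i ≤ p) × P ∣ (sumℤ (suc (suc k)) (λ i → f A B c (n i)) - m)
                × ¬ (P ∣ f A B c (n zero)) × ¬ (P ∣ 12f′ A B c (n zero))
    witness m k 15≤k with good-point
    ... | x₀ , x₀<p , F≢0 , f′≢0 = n , n-range , P∣sum-m , F≢0 , f′≢0
      where
      z = (m - F x₀) %ℕ p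
      large = p+k≤[1+k]*v k (≤-trans (m≤m+n 5 6) 11≤p) 0<|Values| p≤4*|Values| 15≤k
      rest : Representation k z
      rest = Sums-sound k z (Sums-full k large z (%ℕ<p (m - F x₀)))
      xs = proj₁ rest
      n : Fin (suc (suc k)) → ℕ
      n zero    = suc x₀
      n (suc i) = suc (xs i)
      n-range : ∀ i → 1 ≤ n i × n i ≤ p
      n-range zero    = s≤s z≤n , x₀<p
      n-range (suc i) = s≤s z≤n , proj₁ (proj₂ rest) i
      P∣sum-m : P ∣ (F x₀ + sumℤ (suc k) (λ i → F (xs i)) - m)
      P∣sum-m = subst (P ∣_) (regroup (F x₀) (sumℤ (suc k) (λ i → F (xs i))) m (+ z))
                  (∣m∣n⇒∣m-n (proj₂ (proj₂ rest)) (∣-%ℕ (m - F x₀)))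
        where
        regroup : ∀ a s m z → (s - z) - ((m - a) - z) ≡ a + s - m
        regroup = solve-∀

open import Defs
open import Data.Nat using (ℕ; suc; _≤_; _<_; s≤s; z≤n)
open import Data.Nat.Properties using (≤-trans)
open import Data.Nat.Primality using (Prime)
open import Data.Fin using (Fin; zero; fromℕ<)
open import Data.Integer using (ℤ; +_; _-_)
open import Data.Integer.Divisibility using (_∣_)
open import Data.Rational using (↥_)
open import Data.Product using (Σ; _×_; _,_)
open import Relation.Nullary using (¬_)
open import Data.Integer.Divisibility.Signed using (∣⇒∣ᵤ; ∣ᵤ⇒∣)
open import Function using (_∘_)
open Quartic using (∣↥f′⇒∣12f′)

lemma5p6 : (A B c m : ℤ) → + 1 Data.Integer.≤ A →
    (s : ℕ) → (hs : 17 ≤ s) → (p : ℕ) → Prime p → 11 ≤ p →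
    Σ (Fin s → ℕ) (λ n →
    ((i : Fin s) → (1 ≤ n i) × (n i ≤ p))
    × (+ p) ∣ (sumℤ s (λ i → f A B c (n i)) - m)
    × ¬ ((+ p) ∣ f A B c (n (fromℕ< {0} {s} (≤-trans (s≤s z≤n) hs))))
    × ¬ ((+ p) ∣ (↥ (f′ A B c (n (fromℕ< {0} {s} (≤-trans (s≤s z≤n) hs)))))))
lemma5p6 A B c m _ (suc (suc k)) (s≤s (s≤s 15≤k)) p p-prime 11≤p =
  let n , n-range , P∣sum-m , f≢0 , f′≢0 = Construction.witness A B c p p-prime 11≤p m k 15≤k
  in  n , n-range , ∣⇒∣ᵤ P∣sum-m , f≢0 ∘ ∣ᵤ⇒∣ , f′≢0 ∘ ∣↥f′⇒∣12f′ A B c (n zero) ∘ ∣ᵤ⇒∣
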